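{- Let $\mathcal{P} \subseteq \mathbb{R}^n$ and $\mathcal{Q} \subseteq \mathbb{R}^m$ be full-dimensional integrally closed lattice simplices, with $0$ in the interior of $\mathcal{P}$ and $\mathcal{P}$ reflexive. Let $v_0,\ldots,v_m$ be the vertices of $\mathcal{Q}$. Then for each $i \in \{0,\ldots,m\}$ the simplex $$\mathcal{P} *_i \mathcal{Q} := \operatorname{conv}\big((\mathcal{P} \times \{0\}^m) \cup (\{0\}^n \times (\mathcal{Q} - v_i))\big) \subseteq \mathbb{R}^{n+m}$$ is integrally closed.
   Context: A lattice polytope $\mathcal{P} \subseteq \mathbb{R}^N$ is integrally closed if for every positive integer $k$ and every $x \in k\mathcal{P} \cap \mathbb{Z}^N$ there exist $x_1, \ldots, x_k \in \mathcal{P} \cap \mathbb{Z}^N$ with $x = x_1 + \cdots + x_k$. A lattice polytope $\mathcal{P}$ is reflexive if $0$ lies in its interior and its polar dual $\mathcal{P}^{\Delta} := \{y : x \cdot y \le 1 \text{ for all } x \in \mathcal{P}\}$ is also a lattice polytope; a lattice translate of a reflexive polytope is also called reflexive. -}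

module Defs where

open import Data.Nat using (ℕ; zero; suc)
import Data.Nat as ℕ
open import Data.Integer using (ℤ)
import Data.Integer as ℤ
open import Data.Rational using (ℚ; 0ℚ; 1ℚ; _+_; _*_; _-_; _≤_; _<_; ∣_∣; _/_)
open import Data.Fin using (Fin; zero; suc)
open import Data.Product using (Σ; _×_; _,_; ∃)
open import Data.Vec.Functional using (Vector; _++_)
open import Relation.Binary.PropositionalEquality using (_≡_)
open import Function.Bundles using (_⇔_)

Pt : ℕ → Set
Pt N = Fin N → ℚ

LPt : ℕ → Set
LPt N = Fin N → ℤ

ι : ∀ {N} → LPt N → Pt N
ι x i = x i / 1

Σℚ : ∀ {k} → (Fin k → ℚ) → ℚ
Σℚ {zero}  f = 0ℚ
Σℚ {suc k} f = f zero + Σℚ (λ j → f (suc j))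

lincomb : ∀ {k N} → (Fin k → ℚ) → (Fin k → Pt N) → Pt N
lincomb λs vs i = Σℚ (λ j → λs j * vs j i)

Σℤᵛ : ∀ {k N} → (Fin k → LPt N) → LPt N
Σℤᵛ {zero}  xs i = ℤ.+ 0
Σℤᵛ {suc k} xs i = xs zero i ℤ.+ Σℤᵛ (λ j → xs (suc j)) i

dot : ∀ {N} → Pt N → Pt N → ℚ
dot x y = Σℚ (λ i → x i * y i)

-- x ∈ c · conv(V)  (for c = 1: x ∈ conv(V)), V a finite family of points
InDilate : ∀ {k N} → ℚ → (Fin k → Pt N) → Pt N → Set
InDilate c V x = Σ (Fin _ → ℚ) λ λs →
  ((j : Fin _) → 0ℚ ≤ λs j) × (Σℚ λs ≡ c) × ((i : Fin _) → x i ≡ lincomb λs V i)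

InConv : ∀ {k N} → (Fin k → Pt N) → Pt N → Set
InConv V x = InDilate 1ℚ V x

LInConv : ∀ {k N} → (Fin k → LPt N) → Pt N → Set
LInConv V = InConv (λ j → ι (V j))

-- integrally closed: every lattice point of kP (k ≥ 1) is a sum of k lattice points of P
IntegrallyClosed : ∀ {k N} → (Fin k → LPt N) → Set
IntegrallyClosed {N = N} V = (c : ℕ) → (x : LPt N) →
  InDilate (ℤ.+ (suc c) / 1) (λ j → ι (V j)) (ι x) →
  Σ (Fin (suc c) → LPt N) λ xs →
    ((t : Fin (suc c)) → LInConv V (ι (xs t))) × ((i : Fin N) → x i ≡ Σℤᵛ xs i)

AffInd : ∀ {k N} → (Fin k → Pt N) → Set
AffInd {N = N} V = (μ : Fin _ → ℚ) → Σℚ μ ≡ 0ℚ →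
  ((i : Fin N) → lincomb μ V i ≡ 0ℚ) → (j : Fin _) → μ j ≡ 0ℚ

FullDimLatticeSimplex : ∀ {N} → (Fin (suc N) → LPt N) → Set
FullDimLatticeSimplex V = AffInd (λ j → ι (V j))

InInterior : ∀ {k N} → (Fin k → LPt N) → Pt N → Set
InInterior {N = N} V x = Σ ℚ λ ε → (0ℚ < ε) ×
  ((y : Pt N) → ((i : Fin N) → ∣ y i - x i ∣ < ε) → LInConv V y)

zeroPt : ∀ {N} → Pt N
zeroPt i = 0ℚ

zeroL : ∀ {N} → LPt N
zeroL i = ℤ.+ 0

-- reflexive: 0 in the interior and the polar dual
--   P^Δ = { y : x·y ≤ 1 for all x ∈ P }
-- is a lattice polytope, i.e. equals conv(W) for some finite family W of lattice points
Reflexive : ∀ {k N} → (Fin k → LPt N) → Set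
Reflexive {N = N} V = InInterior V zeroPt ×
  Σ ℕ λ r → Σ (Fin r → LPt N) λ W → (y : Pt N) →
    (((x : Pt N) → LInConv V x → dot x y ≤ 1ℚ) ⇔ LInConv W y)

freeSumGens : ∀ {n m} → (Fin (suc n) → LPt n) → (Fin (suc m) → LPt m) → Fin (suc m) →
  Fin (suc n ℕ.+ suc m) → LPt (n ℕ.+ m)
freeSumGens {n} {m} VP VQ i =
  (λ j → VP j ++ zeroL {m}) ++ (λ j → zeroL {n} ++ (λ t → VQ j t ℤ.- VQ i t))

-- Split a convex representation of x ∈ k·(P *ᵢ Q) into its P-part, of total weight s,
-- and its Q-part, of weight t = k − s: the first block a of x lies in s·P. Since P is a
-- reflexive simplex, a already lies in p·P for an integer p ≤ s. Indeed, subtracting from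
-- the barycentric coordinates of a the largest multiple c of those of the origin that keeps
-- them nonnegative puts a on the facet of (s − c)·P opposite some vertex. The normal y of
-- that facet, scaled so that the facet lies on ⟨·, y⟩ = 1, belongs to P^Δ, the convex hull
-- of finitely many lattice points w; since ⟨a, w⟩ ≤ s − c for each of them and the average
-- is ⟨a, y⟩ = s − c, one w attains it, so s − c = ⟨a, w⟩ is an integer p. Moving the
-- leftover weight c onto vᵢ gives b + q·vᵢ ∈ q·Q for the second block b and q = k − p.
-- Integral closedness of P and Q writes a and b + q·vᵢ as sums of p and q lattice points;
-- padded with zeros, and the Q-points translated by −vᵢ, these are k lattice points of
-- P *ᵢ Q summing to x.

module Submission where

open import Data.Nat using (ℕ; zero; suc)
import Data.Nat as ℕ
import Data.Nat.Properties as ℕ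
open import Data.Integer using (ℤ)
import Data.Integer as ℤ
import Data.Integer.Properties as ℤ
import Data.Nat.Coprimality as Coprime
open import Data.Rational
  using (ℚ; mkℚ; ↥_; 0ℚ; 1ℚ; _+_; _*_; _-_; -_; _≤_; _<_; _/_; 1/_; NonZero; ≢-nonZero; nonNegative; positive)
open import Data.Rational.Properties
open import Data.Rational.Solver using (module +-*-Solver)
open import Data.Fin using (Fin; zero; suc; _↑ˡ_; _↑ʳ_; splitAt; join)
open import Data.Fin.Properties using (join-splitAt; ¬∀⟶∃¬; any?)
open import Data.Sum using (inj₁; inj₂)
open import Relation.Nullary using (¬_; yes; no; contradiction)
open import Relation.Unary using (Decidable)
open import Data.Vec.Functional using (_++_; _∷_)
open import Data.Vec.Functional.Properties using (lookup-++ˡ; lookup-++ʳ)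
open import Data.Product using (Σ; ∃; ∃-syntax; _×_; _,_; proj₁; proj₂)
open import Relation.Binary.PropositionalEquality
open import Algebra.Bundles using (CommutativeRing)
open import Function.Bundles using (Equivalence)
open import Function.Base using (case_of_)
import Algebra.Properties.Semiring.Sum as SemiringSum
open import Algebra.Properties.Group (CommutativeRing.+-group +-*-commutativeRing)
  using (x∙y⁻¹≈ε⇒x≈y)
open import Defs

open +-*-Solver

p≤p+q : ∀ {p q} → 0ℚ ≤ q → p ≤ p + q
p≤p+q {p} q≥0 = subst (_≤ p + _) (+-identityʳ p) (+-monoʳ-≤ p q≥0)

p≤q+p : ∀ {p q} → 0ℚ ≤ q → p ≤ q + p
p≤q+p {p} {q} q≥0 = subst (p ≤_) (+-comm p q) (p≤p+q q≥0)

p≤q⇒0≤q-p : ∀ {p q} → p ≤ q → 0ℚ ≤ q - p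
p≤q⇒0≤q-p {p} {q} p≤q = subst (_≤ q - p) (+-inverseʳ p) (+-monoˡ-≤ (- p) p≤q)

p-q≤p : ∀ {p q} → 0ℚ ≤ q → p - q ≤ p
p-q≤p {p} {q} q≥0 = subst (p - q ≤_) (solve 2 (λ p q → p :- q :+ q := p) refl p q) (p≤p+q q≥0)

0≤* : ∀ {p q} → 0ℚ ≤ p → 0ℚ ≤ q → 0ℚ ≤ p * q
0≤* {p} {q} p≥0 q≥0 = nonNegative⁻¹ (p * q)
  {{nonNeg*nonNeg⇒nonNeg p {{nonNegative p≥0}} q {{nonNegative q≥0}}}}

0≤p∧p≢0⇒0<p : ∀ {p} → 0ℚ ≤ p → p ≢ 0ℚ → 0ℚ < p
0≤p∧p≢0⇒0<p {p} p≥0 p≢0 with 0ℚ <? p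
... | yes p>0 = p>0
... | no  p≯0 = contradiction (≤-antisym (≮⇒≥ p≯0) p≥0) p≢0

p≢0∧p*q≡0⇒q≡0 : ∀ {p q} → p ≢ 0ℚ → p * q ≡ 0ℚ → q ≡ 0ℚ
p≢0∧p*q≡0⇒q≡0 {p} {q} p≢0 pq≡0 = begin
  q               ≡⟨ *-identityˡ q ⟨
  1ℚ * q          ≡⟨ cong (_* q) (*-inverseˡ p) ⟨
  1/ p * p * q    ≡⟨ *-assoc (1/ p) p q ⟩
  1/ p * (p * q)  ≡⟨ cong (1/ p *_) pq≡0 ⟩
  1/ p * 0ℚ       ≡⟨ *-zeroʳ (1/ p) ⟩
  0ℚ              ∎
  where
  open ≡-Reasoning
  instance _ = ≢-nonZero p≢0

p*1/q*q≡p : ∀ p q .{{_ : NonZero q}} → p * 1/ q * q ≡ p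
p*1/q*q≡p p q = trans (*-assoc p (1/ q) q) (trans (cong (p *_) (*-inverseˡ q)) (*-identityʳ p))

module ∑ = SemiringSum (CommutativeRing.semiring +-*-commutativeRing)

Σℚ≡sum : ∀ {k} (f : Fin k → ℚ) → Σℚ f ≡ ∑.sum f
Σℚ≡sum {zero}  f = refl
Σℚ≡sum {suc k} f = cong (f zero +_) (Σℚ≡sum (λ j → f (suc j)))

Σℚ-cong : ∀ {k} {f g : Fin k → ℚ} → (∀ j → f j ≡ g j) → Σℚ f ≡ Σℚ g
Σℚ-cong {f = f} {g} f≗g =
  trans (Σℚ≡sum f) (trans (∑.sum-cong-≗ {x = f} {y = g} f≗g) (sym (Σℚ≡sum g)))

Σℚ-+ : ∀ {k} (f g : Fin k → ℚ) → Σℚ (λ j → f j + g j) ≡ Σℚ f + Σℚ g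
Σℚ-+ f g = trans (Σℚ≡sum (λ j → f j + g j))
  (trans (∑.∑-distrib-+ f g) (sym (cong₂ _+_ (Σℚ≡sum f) (Σℚ≡sum g))))

Σℚ-*ˡ : ∀ {k} (c : ℚ) (f : Fin k → ℚ) → Σℚ (λ j → c * f j) ≡ c * Σℚ f
Σℚ-*ˡ c f = trans (Σℚ≡sum (λ j → c * f j))
  (trans (sym (∑.*-distribˡ-sum c f)) (cong (c *_) (sym (Σℚ≡sum f))))

Σℚ-*ʳ : ∀ {k} (c : ℚ) (f : Fin k → ℚ) → Σℚ (λ j → f j * c) ≡ Σℚ f * c
Σℚ-*ʳ c f = trans (Σℚ≡sum (λ j → f j * c))
  (trans (sym (∑.*-distribʳ-sum c f)) (cong (_* c) (sym (Σℚ≡sum f))))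

Σℚ-comm : ∀ {k l} (f : Fin k → Fin l → ℚ) →
  Σℚ (λ j → Σℚ (f j)) ≡ Σℚ (λ i → Σℚ (λ j → f j i))
Σℚ-comm f = begin
  Σℚ (λ j → Σℚ (f j))                ≡⟨ Σℚ-cong (λ j → Σℚ≡sum (f j)) ⟩
  Σℚ (λ j → ∑.sum (f j))             ≡⟨ Σℚ≡sum (λ j → ∑.sum (f j)) ⟩
  ∑.sum (λ j → ∑.sum (f j))          ≡⟨ ∑.∑-comm f ⟩
  ∑.sum (λ i → ∑.sum (λ j → f j i))  ≡⟨ Σℚ≡sum (λ i → ∑.sum (λ j → f j i)) ⟨
  Σℚ (λ i → ∑.sum (λ j → f j i))     ≡⟨ Σℚ-cong (λ i → Σℚ≡sum (λ j → f j i)) ⟨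
  Σℚ (λ i → Σℚ (λ j → f j i))        ∎
  where open ≡-Reasoning

Σℚ-zero : ∀ {k} (f : Fin k → ℚ) → (∀ j → f j ≡ 0ℚ) → Σℚ f ≡ 0ℚ
Σℚ-zero {k} f f≗0 = trans (Σℚ-cong f≗0)
  (trans (Σℚ≡sum {k} (λ _ → 0ℚ)) (∑.sum-replicate-zero k))

Σℚ-sub-* : ∀ {k} (f g : Fin k → ℚ) (c : ℚ) →
  Σℚ (λ j → f j - c * g j) ≡ Σℚ f - c * Σℚ g
Σℚ-sub-* f g c = begin
  Σℚ (λ j → f j - c * g j)     ≡⟨ Σℚ-cong (λ j → cong (f j +_) (neg-distribˡ-* c (g j))) ⟩
  Σℚ (λ j → f j + - c * g j)   ≡⟨ Σℚ-+ f (λ j → - c * g j) ⟩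
  Σℚ f + Σℚ (λ j → - c * g j)  ≡⟨ cong (Σℚ f +_) (Σℚ-*ˡ (- c) g) ⟩
  Σℚ f + - c * Σℚ g            ≡⟨ cong (Σℚ f +_) (neg-distribˡ-* c (Σℚ g)) ⟨
  Σℚ f - c * Σℚ g              ∎
  where open ≡-Reasoning

Σℚ-- : ∀ {k} (f g : Fin k → ℚ) → Σℚ (λ j → f j - g j) ≡ Σℚ f - Σℚ g
Σℚ-- f g = begin
  Σℚ (λ j → f j - g j)       ≡⟨ Σℚ-cong (λ j → cong (_-_ (f j)) (*-identityˡ (g j))) ⟨
  Σℚ (λ j → f j - 1ℚ * g j)  ≡⟨ Σℚ-sub-* f g 1ℚ ⟩
  Σℚ f - 1ℚ * Σℚ g           ≡⟨ cong (_-_ (Σℚ f)) (*-identityˡ (Σℚ g)) ⟩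
  Σℚ f - Σℚ g                ∎
  where open ≡-Reasoning

Σℚ-nonNeg : ∀ {k} (f : Fin k → ℚ) → (∀ j → 0ℚ ≤ f j) → 0ℚ ≤ Σℚ f
Σℚ-nonNeg {zero}  f f≥0 = ≤-refl
Σℚ-nonNeg {suc k} f f≥0 = +-mono-≤ (f≥0 zero) (Σℚ-nonNeg (λ j → f (suc j)) (λ j → f≥0 (suc j)))

Σℚ-mono-≤ : ∀ {k} (f g : Fin k → ℚ) → (∀ j → f j ≤ g j) → Σℚ f ≤ Σℚ g
Σℚ-mono-≤ {zero}  f g f≤g = ≤-refl
Σℚ-mono-≤ {suc k} f g f≤g = +-mono-≤ (f≤g zero) (Σℚ-mono-≤ _ _ (λ j → f≤g (suc j)))

Σℚ-nonNeg-≡0 : ∀ {k} (f : Fin k → ℚ) → (∀ j → 0ℚ ≤ f j) →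
  Σℚ f ≡ 0ℚ → ∀ j → f j ≡ 0ℚ
Σℚ-nonNeg-≡0 {suc k} f f≥0 Σf≡0 = λ
  { zero    → ≤-antisym (subst (f zero ≤_) Σf≡0 (p≤p+q rest≥0)) (f≥0 zero)
  ; (suc j) → Σℚ-nonNeg-≡0 (λ j → f (suc j)) (λ j → f≥0 (suc j)) rest≡0 j }
  where
  rest : ℚ
  rest = Σℚ (λ j → f (suc j))
  rest≥0 : 0ℚ ≤ rest
  rest≥0 = Σℚ-nonNeg (λ j → f (suc j)) (λ j → f≥0 (suc j))
  rest≡0 : rest ≡ 0ℚ
  rest≡0 = ≤-antisym (subst (rest ≤_) Σf≡0 (p≤q+p (f≥0 zero))) rest≥0

Σℚ≢0⇒∃≢0 : ∀ {k} (f : Fin k → ℚ) → Σℚ f ≢ 0ℚ → ∃[ j ] f j ≢ 0ℚ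
Σℚ≢0⇒∃≢0 {k} f Σf≢0 =
  ¬∀⟶∃¬ k (λ j → f j ≡ 0ℚ) (λ j → f j ≟ 0ℚ) (λ f≗0 → Σf≢0 (Σℚ-zero f f≗0))

Σℚ-↑-split : ∀ {a b} (f : Fin (a ℕ.+ b) → ℚ) →
  Σℚ f ≡ Σℚ (λ j → f (j ↑ˡ b)) + Σℚ (λ j → f (a ↑ʳ j))
Σℚ-↑-split {zero}      f = sym (+-identityˡ _)
Σℚ-↑-split {suc a} {b} f =
  trans (cong (f zero +_) (Σℚ-↑-split {a} {b} (λ j → f (suc j)))) (sym (+-assoc (f zero) _ _))

Σℚ-++ : ∀ {a b} (f : Fin a → ℚ) (g : Fin b → ℚ) → Σℚ (f ++ g) ≡ Σℚ f + Σℚ g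
Σℚ-++ {a} {b} f g = trans (Σℚ-↑-split {a} {b} (f ++ g))
  (cong₂ _+_ (Σℚ-cong (lookup-++ˡ f g)) (Σℚ-cong (lookup-++ʳ f g)))

↑-elim : ∀ {a b} (P : Fin (a ℕ.+ b) → Set) →
  (∀ j → P (j ↑ˡ b)) → (∀ j → P (a ↑ʳ j)) → ∀ i → P i
↑-elim {a} {b} P Pˡ Pʳ i = subst P (join-splitAt a b i) (P-join (splitAt a i))
  where
  P-join : ∀ s → P (join a b s)
  P-join (inj₁ j) = Pˡ j
  P-join (inj₂ j) = Pʳ j

++-nonNeg : ∀ {a b} (f : Fin a → ℚ) (g : Fin b → ℚ) →
  (∀ j → 0ℚ ≤ f j) → (∀ j → 0ℚ ≤ g j) → ∀ j → 0ℚ ≤ (f ++ g) j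
++-nonNeg f g f≥0 g≥0 = ↑-elim (λ j → 0ℚ ≤ (f ++ g) j)
  (λ j → subst (0ℚ ≤_) (sym (lookup-++ˡ f g j)) (f≥0 j))
  (λ j → subst (0ℚ ≤_) (sym (lookup-++ʳ f g j)) (g≥0 j))

δ : ∀ {k} → Fin k → Fin k → ℚ
δ zero    zero    = 1ℚ
δ zero    (suc j) = 0ℚ
δ (suc p) zero    = 0ℚ
δ (suc p) (suc j) = δ p j

δ-nonNeg : ∀ {k} (p j : Fin k) → 0ℚ ≤ δ p j
δ-nonNeg zero    zero    = nonNegative⁻¹ 1ℚ
δ-nonNeg zero    (suc j) = ≤-refl
δ-nonNeg (suc p) zero    = ≤-refl
δ-nonNeg (suc p) (suc j) = δ-nonNeg p j

Σℚ-δ-* : ∀ {k} (p : Fin k) (f : Fin k → ℚ) → Σℚ (λ j → δ p j * f j) ≡ f p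
Σℚ-δ-* {suc k} zero f = begin
  1ℚ * f zero + Σℚ (λ j → 0ℚ * f (suc j))
    ≡⟨ cong₂ _+_ (*-identityˡ (f zero)) (Σℚ-zero _ (λ j → *-zeroˡ (f (suc j)))) ⟩
  f zero + 0ℚ                              ≡⟨ +-identityʳ (f zero) ⟩
  f zero                                   ∎
  where open ≡-Reasoning
Σℚ-δ-* {suc k} (suc p) f = begin
  0ℚ * f zero + Σℚ (λ j → δ p j * f (suc j))  ≡⟨ cong₂ _+_ (*-zeroˡ (f zero)) (Σℚ-δ-* p (λ j → f (suc j))) ⟩
  0ℚ + f (suc p)                              ≡⟨ +-identityˡ (f (suc p)) ⟩
  f (suc p)                                   ∎
  where open ≡-Reasoning

Σℚ-δ : ∀ {k} (p : Fin k) → Σℚ (δ p) ≡ 1ℚ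
Σℚ-δ p = trans (Σℚ-cong (λ j → sym (*-identityʳ (δ p j)))) (Σℚ-δ-* p (λ _ → 1ℚ))

/1-normal : ∀ z → z / 1 ≡ mkℚ z 0 (Coprime.sym (Coprime.1-coprimeTo ℤ.∣ z ∣))
/1-normal (ℤ.+ n)    = normalize-coprime (Coprime.sym (Coprime.1-coprimeTo n))
/1-normal ℤ.-[1+ n ] = cong -_ (normalize-coprime (Coprime.sym (Coprime.1-coprimeTo (suc n))))

/1-homo-+ : ∀ a b → (a ℤ.+ b) / 1 ≡ a / 1 + b / 1
/1-homo-+ a b rewrite /1-normal a | /1-normal b =
  sym (cong (_/ 1) (cong₂ ℤ._+_ (ℤ.*-identityʳ a) (ℤ.*-identityʳ b)))

/1-homo-* : ∀ a b → (a ℤ.* b) / 1 ≡ a / 1 * (b / 1)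
/1-homo-* a b rewrite /1-normal a | /1-normal b = refl

/1-homo‿- : ∀ a → (ℤ.- a) / 1 ≡ - (a / 1)
/1-homo‿- a rewrite /1-normal a | /1-normal (ℤ.- a) with a
... | ℤ.+ zero   = refl
... | ℤ.+ suc n  = refl
... | ℤ.-[1+ n ] = refl

/1-homo-- : ∀ a b → (a ℤ.- b) / 1 ≡ a / 1 - b / 1
/1-homo-- a b = trans (/1-homo-+ a (ℤ.- b)) (cong (a / 1 +_) (/1-homo‿- b))

/1-injective : ∀ {a b} → a / 1 ≡ b / 1 → a ≡ b
/1-injective {a} {b} eq rewrite /1-normal a | /1-normal b = cong ↥_ eq

/1-nonNeg⇒ℕ : ∀ a → 0ℚ ≤ a / 1 → ∃[ p ] a ≡ ℤ.+ p
/1-nonNeg⇒ℕ a a≥0 rewrite /1-normal a = ℤ.∣ a ∣ , sym (ℤ.0≤i⇒+∣i∣≡i 0≤a)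
  where
  0≤a : ℤ.+ 0 ℤ.≤ a
  0≤a = subst (ℤ.+ 0 ℤ.≤_) (ℤ.*-identityʳ a) (drop-*≤* a≥0)

/1-cancel-≤ : ∀ {p q} → (ℤ.+ p) / 1 ≤ (ℤ.+ q) / 1 → p ℕ.≤ q
/1-cancel-≤ {p} {q} p≤q rewrite /1-normal (ℤ.+ p) | /1-normal (ℤ.+ q) =
  ℤ.drop‿+≤+ (subst₂ ℤ._≤_ (ℤ.*-identityʳ (ℤ.+ p)) (ℤ.*-identityʳ (ℤ.+ q)) (drop-*≤* p≤q))

Σℚ-const : ∀ k (c : ℚ) → Σℚ {k} (λ _ → c) ≡ (ℤ.+ k) / 1 * c
Σℚ-const zero    c = sym (*-zeroˡ c)
Σℚ-const (suc k) c = begin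
  c + Σℚ {k} (λ _ → c)            ≡⟨ cong (c +_) (Σℚ-const k c) ⟩
  c + (ℤ.+ k) / 1 * c
    ≡⟨ solve 2 (λ c K → c :+ K :* c := (con 1ℚ :+ K) :* c) refl c ((ℤ.+ k) / 1) ⟩
  (1ℚ + (ℤ.+ k) / 1) * c          ≡⟨ cong (_* c) (/1-homo-+ (ℤ.+ 1) (ℤ.+ k)) ⟨
  (ℤ.+ suc k) / 1 * c             ∎
  where open ≡-Reasoning

Integral : ℚ → Set
Integral q = ∃[ z ] q ≡ z / 1

Σℚ-integral : ∀ {k} (f : Fin k → ℚ) → (∀ j → Integral (f j)) → Integral (Σℚ f)
Σℚ-integral {zero}  f _      = ℤ.+ 0 , refl
Σℚ-integral {suc k} f f∈ℤ with f∈ℤ zero | Σℚ-integral (λ j → f (suc j)) (λ j → f∈ℤ (suc j))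
... | a , fa | b , fb = a ℤ.+ b , trans (cong₂ _+_ fa fb) (sym (/1-homo-+ a b))

dot-integral : ∀ {N} (a w : LPt N) → Integral (dot (ι a) (ι w))
dot-integral a w = Σℚ-integral _ (λ i → a i ℤ.* w i , sym (/1-homo-* (a i) (w i)))

integral-nonNeg⇒ℕ : ∀ {M} → Integral M → 0ℚ ≤ M → ∃[ p ] M ≡ (ℤ.+ p) / 1
integral-nonNeg⇒ℕ (z , M≡z) M≥0 with /1-nonNeg⇒ℕ z (subst (0ℚ ≤_) M≡z M≥0)
... | p , z≡p = p , trans M≡z (cong (_/ 1) z≡p)

Σℤᵛ-/1 : ∀ {k N} (xs : Fin k → LPt N) i → Σℤᵛ xs i / 1 ≡ Σℚ (λ t → xs t i / 1)
Σℤᵛ-/1 {zero}  xs i = refl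
Σℤᵛ-/1 {suc k} xs i =
  trans (/1-homo-+ (xs zero i) _) (cong (xs zero i / 1 +_) (Σℤᵛ-/1 (λ t → xs (suc t)) i))

vertex∈conv : ∀ {k N} (V : Fin k → Pt N) (l : Fin k) → InConv V (V l)
vertex∈conv V l = δ l , δ-nonNeg l , Σℚ-δ l , λ i → sym (Σℚ-δ-* l (λ j → V j i))

InDilate-cong : ∀ {k N} {c c′ : ℚ} {V : Fin k → Pt N} {x x′ : Pt N} →
  c ≡ c′ → (∀ i → x i ≡ x′ i) → InDilate c V x → InDilate c′ V x′
InDilate-cong refl x≗x′ (γ , γ≥0 , Σγ≡c , x≡γV) =
  γ , γ≥0 , Σγ≡c , λ i → trans (sym (x≗x′ i)) (x≡γV i)

InDilate-zero : ∀ {k N} {V : Fin k → Pt N} {x : Pt N} → InDilate 0ℚ V x → ∀ i → x i ≡ 0ℚ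
InDilate-zero {V = V} (γ , γ≥0 , Σγ≡0 , x≡γV) i = trans (x≡γV i)
  (Σℚ-zero _ (λ j → trans (cong (_* V j i) (Σℚ-nonNeg-≡0 γ γ≥0 Σγ≡0 j)) (*-zeroˡ (V j i))))

IntegrallyClosed⇒sum : ∀ {k N} (V : Fin k → LPt N) → IntegrallyClosed V →
  (p : ℕ) (x : LPt N) → InDilate ((ℤ.+ p) / 1) (λ j → ι (V j)) (ι x) →
  Σ (Fin p → LPt N) λ xs → (∀ t → LInConv V (ι (xs t))) × (∀ i → x i ≡ Σℤᵛ xs i)
IntegrallyClosed⇒sum V closed zero    x x∈0P =
  (λ ()) , (λ ()) , λ i → /1-injective (InDilate-zero x∈0P i)
IntegrallyClosed⇒sum V closed (suc p) x x∈kP = closed p x x∈kP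

lincomb-sub-* : ∀ {k N} (α β : Fin k → ℚ) (c : ℚ) (V : Fin k → Pt N) (i : Fin N) →
  lincomb (λ l → α l - c * β l) V i ≡ lincomb α V i - c * lincomb β V i
lincomb-sub-* α β c V i = trans
  (Σℚ-cong (λ l → solve 4 (λ a b c v → (a :- c :* b) :* v := a :* v :- c :* (b :* v))
    refl (α l) (β l) c (V l i)))
  (Σℚ-sub-* (λ l → α l * V l i) (λ l → β l * V l i) c)

lincomb-zeroˡ : ∀ {k N} (γ : Fin k → ℚ) (V : Fin k → Pt N) (i : Fin N) →
  (∀ j → γ j ≡ 0ℚ) → lincomb γ V i ≡ 0ℚ
lincomb-zeroˡ γ V i γ≡0 = Σℚ-zero _ (λ j → trans (cong (_* V j i) (γ≡0 j)) (*-zeroˡ (V j i)))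

InDilate-addVertex : ∀ {k N} {t : ℚ} (c : ℚ) (V : Fin k → Pt N) {x : Pt N} (j : Fin k) → 0ℚ ≤ c →
  InDilate t V x → InDilate (t + c) V (λ i → x i + c * V j i)
InDilate-addVertex {k} {t = t} c V {x} j c≥0 (γ , γ≥0 , Σγ≡t , x≡γV) =
  γ′ , γ′≥0 , Σγ′≡t+c , x+cv≡γ′V
  where
  γ′ : Fin k → ℚ
  γ′ l = γ l + c * δ j l
  γ′≥0 : ∀ l → 0ℚ ≤ γ′ l
  γ′≥0 l = +-mono-≤ (γ≥0 l) (0≤* c≥0 (δ-nonNeg j l))
  Σγ′≡t+c : Σℚ γ′ ≡ t + c
  Σγ′≡t+c = trans (Σℚ-+ γ (λ l → c * δ j l))
    (cong₂ _+_ Σγ≡t (trans (Σℚ-*ˡ c (δ j)) (trans (cong (c *_) (Σℚ-δ j)) (*-identityʳ c))))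
  x+cv≡γ′V : ∀ i → x i + c * V j i ≡ lincomb γ′ V i
  x+cv≡γ′V i = begin
    x i + c * V j i
      ≡⟨ cong₂ _+_ (x≡γV i) (cong (c *_) (sym (Σℚ-δ-* j (λ l → V l i)))) ⟩
    lincomb γ V i + c * Σℚ (λ l → δ j l * V l i)
      ≡⟨ cong (lincomb γ V i +_) (Σℚ-*ˡ c (λ l → δ j l * V l i)) ⟨
    lincomb γ V i + Σℚ (λ l → c * (δ j l * V l i))
      ≡⟨ Σℚ-+ (λ l → γ l * V l i) (λ l → c * (δ j l * V l i)) ⟨
    Σℚ (λ l → γ l * V l i + c * (δ j l * V l i))
      ≡⟨ Σℚ-cong (λ l → solve 4 (λ g c d v → g :* v :+ c :* (d :* v) := (g :+ c :* d) :* v)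
           refl (γ l) c (δ j l) (V l i)) ⟩
    lincomb γ′ V i                                 ∎
    where open ≡-Reasoning

dot-comm : ∀ {N} (x y : Pt N) → dot x y ≡ dot y x
dot-comm x y = Σℚ-cong (λ i → *-comm (x i) (y i))

dot-lincomb : ∀ {k N} (γ : Fin k → ℚ) (V : Fin k → Pt N) (x y : Pt N) →
  (∀ i → x i ≡ lincomb γ V i) → dot x y ≡ Σℚ (λ l → γ l * dot (V l) y)
dot-lincomb γ V x y x≡γV = begin
  Σℚ (λ i → x i * y i)                        ≡⟨ Σℚ-cong (λ i → cong (_* y i) (x≡γV i)) ⟩
  Σℚ (λ i → Σℚ (λ l → γ l * V l i) * y i)     ≡⟨ Σℚ-cong (λ i → sym (Σℚ-*ʳ (y i) (λ l → γ l * V l i))) ⟩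
  Σℚ (λ i → Σℚ (λ l → γ l * V l i * y i))     ≡⟨ Σℚ-comm (λ l i → γ l * V l i * y i) ⟨
  Σℚ (λ l → Σℚ (λ i → γ l * V l i * y i))
    ≡⟨ Σℚ-cong (λ l → trans (Σℚ-cong (λ i → *-assoc (γ l) (V l i) (y i)))
                            (Σℚ-*ˡ (γ l) (λ i → V l i * y i))) ⟩
  Σℚ (λ l → γ l * dot (V l) y)                ∎
  where open ≡-Reasoning

InDilate-dot-≤ : ∀ {k N} {c : ℚ} (V : Fin k → Pt N) (x y : Pt N) →
  (∀ l → dot (V l) y ≤ 1ℚ) → InDilate c V x → dot x y ≤ c
InDilate-dot-≤ {c = c} V x y Vy≤1 (γ , γ≥0 , Σγ≡c , x≡γV) = begin
  dot x y                          ≡⟨ dot-lincomb γ V x y x≡γV ⟩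
  Σℚ (λ l → γ l * dot (V l) y)
    ≤⟨ Σℚ-mono-≤ _ _ (λ l → *-monoˡ-≤-nonNeg (γ l) {{nonNegative (γ≥0 l)}} (Vy≤1 l)) ⟩
  Σℚ (λ l → γ l * 1ℚ)              ≡⟨ Σℚ-cong (λ l → *-identityʳ (γ l)) ⟩
  Σℚ γ                             ≡⟨ Σγ≡c ⟩
  c                                ∎
  where open ≤-Reasoning

dot-attainsBound-atVertex : ∀ {k N} (W : Fin k → Pt N) (a y : Pt N) (M : ℚ) → InConv W y →
  (∀ q → dot a (W q) ≤ M) → dot a y ≡ M → ∃[ q ] dot a (W q) ≡ M
dot-attainsBound-atVertex {k} W a y M (ν , ν≥0 , Σν≡1 , y≡νW) a·W≤M a·y≡M
  with Σℚ≢0⇒∃≢0 ν (λ Σν≡0 → 1≢0 (trans (sym Σν≡1) Σν≡0))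
... | q , νq≢0 =
  q , sym (x∙y⁻¹≈ε⇒x≈y M (f q) (p≢0∧p*q≡0⇒q≡0 νq≢0 (Σℚ-nonNeg-≡0 gap gap≥0 Σgap≡0 q)))
  where
  f : Fin k → ℚ
  f q = dot a (W q)
  gap : Fin k → ℚ
  gap q = ν q * (M - f q)
  gap≥0 : ∀ q → 0ℚ ≤ gap q
  gap≥0 q = 0≤* (ν≥0 q) (p≤q⇒0≤q-p (a·W≤M q))
  Σνf≡M : Σℚ (λ q → ν q * f q) ≡ M
  Σνf≡M = begin
    Σℚ (λ q → ν q * dot a (W q))  ≡⟨ Σℚ-cong (λ q → cong (ν q *_) (dot-comm a (W q))) ⟩
    Σℚ (λ q → ν q * dot (W q) a)  ≡⟨ dot-lincomb ν W y a y≡νW ⟨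
    dot y a                       ≡⟨ dot-comm y a ⟩
    dot a y                       ≡⟨ a·y≡M ⟩
    M                             ∎
    where open ≡-Reasoning
  Σgap≡0 : Σℚ gap ≡ 0ℚ
  Σgap≡0 = begin
    Σℚ (λ q → ν q * (M - f q))
      ≡⟨ Σℚ-cong (λ q → solve 3 (λ v m x → v :* (m :- x) := m :* v :- v :* x) refl (ν q) M (f q)) ⟩
    Σℚ (λ q → M * ν q - ν q * f q)             ≡⟨ Σℚ-- (λ q → M * ν q) (λ q → ν q * f q) ⟩
    Σℚ (λ q → M * ν q) - Σℚ (λ q → ν q * f q)
      ≡⟨ cong₂ _-_ (trans (Σℚ-*ˡ M ν) (trans (cong (M *_) Σν≡1) (*-identityʳ M))) Σνf≡M ⟩
    M - M                                      ≡⟨ +-inverseʳ M ⟩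
    0ℚ                                         ∎
    where open ≡-Reasoning

LinearlyIndependent : ∀ {k N} → (Fin k → Pt N) → Set
LinearlyIndependent {k} {N} M =
  (α : Fin k → ℚ) → (∀ i → lincomb α M i ≡ 0ℚ) → ∀ l → α l ≡ 0ℚ

rowReduce-independent : ∀ {k N} (M : Fin (suc k) → Pt N) (κ : Fin k → ℚ) →
  LinearlyIndependent M → LinearlyIndependent (λ l i → M (suc l) i - κ l * M zero i)
rowReduce-independent M κ indep α α·M′≡0 l = indep (α₀ ∷ α) α·M≡0 (suc l)
  where
  α₀ : ℚ
  α₀ = - Σℚ (λ l → α l * κ l)
  α·M≡0 : ∀ i → lincomb (α₀ ∷ α) M i ≡ 0ℚ
  α·M≡0 i = begin
    α₀ * M zero i + A
      ≡⟨ solve 3 (λ s m a → :- s :* m :+ a := a :- m :* s) refl (Σℚ (λ l → α l * κ l)) (M zero i) A ⟩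
    A - M zero i * Σℚ (λ l → α l * κ l)
      ≡⟨ Σℚ-sub-* (λ l → α l * M (suc l) i) (λ l → α l * κ l) (M zero i) ⟨
    Σℚ (λ l → α l * M (suc l) i - M zero i * (α l * κ l))
      ≡⟨ Σℚ-cong (λ l → solve 4 (λ a x k m → a :* x :- m :* (a :* k) := a :* (x :- k :* m))
           refl (α l) (M (suc l) i) (κ l) (M zero i)) ⟩
    Σℚ (λ l → α l * (M (suc l) i - κ l * M zero i))    ≡⟨ α·M′≡0 i ⟩
    0ℚ                                                 ∎
    where
    open ≡-Reasoning
    A : ℚ
    A = Σℚ (λ l → α l * M (suc l) i)

dot-update : ∀ {N} (r u : Pt N) (τ : ℚ) (p : Fin N) →
  dot r (λ i → u i + τ * δ p i) ≡ dot r u + τ * r p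
dot-update r u τ p = begin
  Σℚ (λ i → r i * (u i + τ * δ p i))
    ≡⟨ Σℚ-cong (λ i → solve 4 (λ r u t d → r :* (u :+ t :* d) := r :* u :+ t :* (d :* r))
         refl (r i) (u i) τ (δ p i)) ⟩
  Σℚ (λ i → r i * u i + τ * (δ p i * r i))   ≡⟨ Σℚ-+ (λ i → r i * u i) _ ⟩
  dot r u + Σℚ (λ i → τ * (δ p i * r i))
    ≡⟨ cong (dot r u +_) (trans (Σℚ-*ˡ τ (λ i → δ p i * r i)) (cong (τ *_) (Σℚ-δ-* p r))) ⟩
  dot r u + τ * r p                          ∎
  where open ≡-Reasoning

dot-rowReduce : ∀ {N} (r r₀ u : Pt N) (κ : ℚ) →
  dot (λ i → r i - κ * r₀ i) u ≡ dot r u - κ * dot r₀ u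
dot-rowReduce r r₀ u κ = trans
  (Σℚ-cong (λ i → solve 4 (λ r r₀ u k → (r :- k :* r₀) :* u := r :* u :- k :* (r₀ :* u))
    refl (r i) (r₀ i) (u i) κ))
  (Σℚ-sub-* (λ i → r i * u i) (λ i → r₀ i * u i) κ)

independent⇒solvable : ∀ k {N} (M : Fin k → Pt N) → LinearlyIndependent M →
  (b : Fin k → ℚ) → ∃[ u ] ∀ l → dot (M l) u ≡ b l
independent⇒solvable zero    M indep b = (λ _ → 0ℚ) , λ ()
independent⇒solvable (suc k) {N} M indep b
  with ¬∀⟶∃¬ N (λ i → M zero i ≡ 0ℚ) (λ i → M zero i ≟ 0ℚ) M₀≢0
  where
  M₀≢0 : ¬ (∀ i → M zero i ≡ 0ℚ)
  M₀≢0 M₀≡0 = 1≢0 (indep (δ zero) (λ i → trans (Σℚ-δ-* zero (λ l → M l i)) (M₀≡0 i)) zero)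
... | p , π≢0 = u , solves
  where
  instance _ = ≢-nonZero π≢0
  π : ℚ
  π = M zero p
  κ : Fin k → ℚ
  κ l = M (suc l) p * 1/ π
  reduced : ∃[ u′ ] ∀ l → dot (λ i → M (suc l) i - κ l * M zero i) u′ ≡ b (suc l) - κ l * b zero
  reduced = independent⇒solvable k (λ l i → M (suc l) i - κ l * M zero i)
    (rowReduce-independent M κ indep) (λ l → b (suc l) - κ l * b zero)
  u′ : Pt N
  u′ = proj₁ reduced
  D : ℚ
  D = dot (M zero) u′
  τ : ℚ
  τ = (b zero - D) * 1/ π
  u : Pt N
  u i = u′ i + τ * δ p i
  solves : ∀ l → dot (M l) u ≡ b l
  solves zero = begin
    dot (M zero) u                 ≡⟨ dot-update (M zero) u′ τ p ⟩
    D + (b zero - D) * 1/ π * π    ≡⟨ cong (D +_) (*-assoc (b zero - D) (1/ π) π) ⟩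
    D + (b zero - D) * (1/ π * π)  ≡⟨ cong (λ z → D + (b zero - D) * z) (*-inverseˡ π) ⟩
    D + (b zero - D) * 1ℚ          ≡⟨ solve 2 (λ d b → d :+ (b :- d) :* con 1ℚ := b) refl D (b zero) ⟩
    b zero                         ∎
    where open ≡-Reasoning
  solves (suc l) = begin
    dot (M (suc l)) u                  ≡⟨ dot-update (M (suc l)) u′ τ p ⟩
    A + τ * M (suc l) p                ≡⟨ cong (_+ τ * M (suc l) p) A≡ ⟩
    (b (suc l) - κ l * b zero + κ l * D) + τ * M (suc l) p
      ≡⟨ solve 5 (λ B m i b₀ d → (B :- m :* i :* b₀ :+ m :* i :* d) :+ (b₀ :- d) :* i :* m := B)
           refl (b (suc l)) (M (suc l) p) (1/ π) (b zero) D ⟩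
    b (suc l)                          ∎
    where
    open ≡-Reasoning
    A : ℚ
    A = dot (M (suc l)) u′
    A≡ : A ≡ b (suc l) - κ l * b zero + κ l * D
    A≡ = begin
      A                               ≡⟨ solve 2 (λ a x → a := a :- x :+ x) refl A (κ l * D) ⟩
      A - κ l * D + κ l * D
        ≡⟨ cong (_+ κ l * D) (trans (sym (dot-rowReduce (M (suc l)) (M zero) u′ (κ l))) (proj₂ reduced l)) ⟩
      b (suc l) - κ l * b zero + κ l * D  ∎

-- Reflexive simplices

-- The weight f may use its proof argument only irrelevantly, so f j p and f j p′ agree
-- by definition.
argmin : ∀ {N} {P : Fin N → Set} → Decidable P → (f : ∀ j → .(P j) → ℚ) → ∃ P →
  ∃[ j ] Σ (P j) λ pj → ∀ k (pk : P k) → f j pj ≤ f k pk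
argmin {suc N} P? f (j , pj) with P? zero
argmin {suc N} P? f (zero , p₀) | no ¬p₀ = contradiction p₀ ¬p₀
argmin {suc N} P? f (suc j , pj) | no ¬p₀ with argmin (λ k → P? (suc k)) (λ k → f (suc k)) (j , pj)
... | j₁ , p₁ , min₁ = suc j₁ , p₁ , λ { zero p₀ → contradiction p₀ ¬p₀ ; (suc k) pk → min₁ k pk }
argmin {suc N} P? f (j , pj) | yes p₀ with any? (λ k → P? (suc k))
... | no ¬tail = zero , p₀ , λ { zero _ → ≤-refl ; (suc k) pk → contradiction (k , pk) ¬tail }
... | yes tail with argmin (λ k → P? (suc k)) (λ k → f (suc k)) tail
... | j₁ , p₁ , min₁ with ≤-total (f zero p₀) (f (suc j₁) p₁)
... | inj₁ f₀≤f₁ = zero , p₀ , λ { zero _ → ≤-refl ; (suc k) pk → ≤-trans f₀≤f₁ (min₁ k pk) }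
... | inj₂ f₁≤f₀ = suc j₁ , p₁ , λ { zero _ → f₁≤f₀ ; (suc k) pk → min₁ k pk }

record MinRatio {k} (β λs : Fin k → ℚ) : Set where
  field
    j₀          : Fin k
    c           : ℚ
    β[j₀]>0     : 0ℚ < β j₀
    c≥0         : 0ℚ ≤ c
    λs-cβ≥0     : ∀ j → 0ℚ ≤ λs j - c * β j
    λs-cβ[j₀]≡0 : λs j₀ - c * β j₀ ≡ 0ℚ

minRatio : ∀ {k} (β λs : Fin k → ℚ) → (∀ j → 0ℚ ≤ β j) → (∀ j → 0ℚ ≤ λs j) →
  ∃[ j ] 0ℚ < β j → MinRatio β λs
minRatio β λs β≥0 λs≥0 β>0
  with argmin (λ j → 0ℚ <? β j) ratio β>0
  where
  ratio : ∀ j → .(0ℚ < β j) → ℚ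
  ratio j βj>0 = λs j * (1/ β j) {{pos⇒nonZero (β j) {{positive βj>0}}}}
... | j₀ , βj₀>0 , minimal = record
  { j₀          = j₀
  ; c           = c
  ; β[j₀]>0     = βj₀>0
  ; c≥0         = 0≤* (λs≥0 j₀) (<⇒≤ (positive⁻¹ (1/ β j₀) {{1/pos⇒pos (β j₀) {{positive βj₀>0}}}}))
  ; λs-cβ≥0     = λs-cβ≥0
  ; λs-cβ[j₀]≡0 = trans (cong (_-_ (λs j₀)) (p*1/q*q≡p (λs j₀) (β j₀))) (+-inverseʳ (λs j₀))
  }
  where
  instance _ = pos⇒nonZero (β j₀) {{positive βj₀>0}}
  c : ℚ
  c = λs j₀ * 1/ β j₀
  λs-cβ≥0 : ∀ j → 0ℚ ≤ λs j - c * β j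
  λs-cβ≥0 j with 0ℚ <? β j
  ... | yes βj>0 = p≤q⇒0≤q-p (subst (c * β j ≤_) (p*1/q*q≡p (λs j) (β j))
          (*-monoʳ-≤-nonNeg (β j) {{nonNegative (β≥0 j)}} (minimal j βj>0)))
    where instance _ = pos⇒nonZero (β j) {{positive βj>0}}
  ... | no βj≯0 = subst (0ℚ ≤_) λs≡λs-cβ (λs≥0 j)
    where
    λs≡λs-cβ : λs j ≡ λs j - c * β j
    λs≡λs-cβ = trans (solve 2 (λ l c → l := l :- c :* con 0ℚ) refl (λs j) c)
      (cong (λ b → λs j - c * b) (≤-antisym (β≥0 j) (≮⇒≥ βj≯0)))

-- Appending δ j₀ l to V l finds the hyperplane through all vertices but the j₀-th without
-- deleting a row: a solution (d , y) of ⟨δ j₀ l ∷ V l , (d , y)⟩ = 1 has ⟨V l , y⟩ = 1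
-- for l ≢ j₀. Independence of these rows is where affine independence enters.
affInd⇒facetRows-independent : ∀ {n} (V : Fin (suc n) → Pt n) → AffInd V →
  (β : Fin (suc n) → ℚ) → Σℚ β ≡ 1ℚ → (∀ i → lincomb β V i ≡ 0ℚ) →
  (j₀ : Fin (suc n)) → β j₀ ≢ 0ℚ → LinearlyIndependent (λ l → δ j₀ l ∷ V l)
affInd⇒facetRows-independent V affInd β Σβ≡1 βV≡0 j₀ βj₀≢0 α αR≡0 l = begin
  α l                ≡⟨ solve 3 (λ a s b → a := a :- s :* b :+ s :* b) refl (α l) S (β l) ⟩
  μ l + S * β l      ≡⟨ cong₂ (λ x y → x + y * β l) (μ≡0 l) S≡0 ⟩
  0ℚ + 0ℚ * β l      ≡⟨ solve 1 (λ b → con 0ℚ :+ con 0ℚ :* b := con 0ℚ) refl (β l) ⟩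
  0ℚ                 ∎
  where
  open ≡-Reasoning
  S : ℚ
  S = Σℚ α
  μ : Fin _ → ℚ
  μ l = α l - S * β l
  αj₀≡0 : α j₀ ≡ 0ℚ
  αj₀≡0 = trans (sym (trans (Σℚ-cong (λ l → *-comm (α l) (δ j₀ l))) (Σℚ-δ-* j₀ α))) (αR≡0 zero)
  μ≡0 : ∀ l → μ l ≡ 0ℚ
  μ≡0 = affInd μ
    (trans (Σℚ-sub-* α β S)
      (trans (cong (λ b → S - S * b) Σβ≡1) (solve 1 (λ s → s :- s :* con 1ℚ := con 0ℚ) refl S)))
    (λ i → trans (lincomb-sub-* α β S V i) (trans (cong₂ (λ x y → x - S * y) (αR≡0 (suc i)) (βV≡0 i))
      (solve 1 (λ s → con 0ℚ :- s :* con 0ℚ := con 0ℚ) refl S)))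
  S≡0 : S ≡ 0ℚ
  S≡0 = p≢0∧p*q≡0⇒q≡0 βj₀≢0 (begin
    β j₀ * S           ≡⟨ solve 3 (λ b s a → b :* s := a :- (a :- s :* b)) refl (β j₀) S (α j₀) ⟩
    α j₀ - μ j₀        ≡⟨ cong₂ _-_ αj₀≡0 (μ≡0 j₀) ⟩
    0ℚ - 0ℚ            ≡⟨ +-inverseʳ 0ℚ ⟩
    0ℚ                 ∎)

record FacetNormal {n} (V : Fin (suc n) → Pt n) (j₀ : Fin (suc n)) : Set where
  field
    y     : Pt n
    d     : ℚ
    d≥0   : 0ℚ ≤ d
    V·y≡  : ∀ l → dot (V l) y ≡ 1ℚ - δ j₀ l * d

facetNormal : ∀ {n} (V : Fin (suc n) → Pt n) → AffInd V →
  (β : Fin (suc n) → ℚ) → Σℚ β ≡ 1ℚ → (∀ i → lincomb β V i ≡ 0ℚ) →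
  (j₀ : Fin (suc n)) → 0ℚ < β j₀ → FacetNormal V j₀
facetNormal {n} V affInd β Σβ≡1 βV≡0 j₀ βj₀>0 = record { y = y ; d = d ; d≥0 = d≥0 ; V·y≡ = V·y≡ }
  where
  solution : ∃[ u ] ∀ l → dot (δ j₀ l ∷ V l) u ≡ 1ℚ
  solution = independent⇒solvable _ (λ l → δ j₀ l ∷ V l)
    (affInd⇒facetRows-independent V affInd β Σβ≡1 βV≡0 j₀ (≢-sym (<⇒≢ βj₀>0))) (λ _ → 1ℚ)
  d : ℚ
  d = proj₁ solution zero
  y : Pt n
  y i = proj₁ solution (suc i)
  V·y≡ : ∀ l → dot (V l) y ≡ 1ℚ - δ j₀ l * d
  V·y≡ l = trans (solve 2 (λ t x → x := t :+ x :- t) refl (δ j₀ l * d) (dot (V l) y))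
    (cong (_- δ j₀ l * d) (proj₂ solution l))
  1-dβj₀≡0 : 1ℚ - d * β j₀ ≡ 0ℚ
  1-dβj₀≡0 = begin
    1ℚ - d * β j₀                         ≡⟨ cong₂ (λ x z → x - d * z) Σβ≡1 (Σℚ-δ-* j₀ β) ⟨
    Σℚ β - d * Σℚ (λ l → δ j₀ l * β l)    ≡⟨ Σℚ-sub-* β (λ l → δ j₀ l * β l) d ⟨
    Σℚ (λ l → β l - d * (δ j₀ l * β l))
      ≡⟨ Σℚ-cong (λ l → solve 3 (λ b d e → b :- d :* (e :* b) := b :* (con 1ℚ :- e :* d))
           refl (β l) d (δ j₀ l)) ⟩
    Σℚ (λ l → β l * (1ℚ - δ j₀ l * d))    ≡⟨ Σℚ-cong (λ l → cong (β l *_) (V·y≡ l)) ⟨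
    Σℚ (λ l → β l * dot (V l) y)          ≡⟨ dot-lincomb β V zeroPt y (λ i → sym (βV≡0 i)) ⟨
    dot zeroPt y                          ≡⟨ Σℚ-zero _ (λ i → *-zeroˡ (y i)) ⟩
    0ℚ                                    ∎
    where open ≡-Reasoning
  βj₀d≡1 : β j₀ * d ≡ 1ℚ
  βj₀d≡1 = trans (*-comm (β j₀) d) (sym (x∙y⁻¹≈ε⇒x≈y 1ℚ (d * β j₀) 1-dβj₀≡0))
  d≥0 : 0ℚ ≤ d
  d≥0 = *-cancelˡ-≤-pos (β j₀) {{positive βj₀>0}}
    (subst₂ _≤_ (sym (*-zeroʳ (β j₀))) (sym βj₀d≡1) (nonNegative⁻¹ 1ℚ))

reflexive⇒supportValue-ℕ : ∀ {k N} (V : Fin k → LPt N) → Reflexive V →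
  (y : Pt N) → (∀ l → dot (ι (V l)) y ≤ 1ℚ) →
  (M : ℚ) (a : LPt N) → InDilate M (λ l → ι (V l)) (ι a) → dot (ι a) y ≡ M →
  ∃[ p ] M ≡ (ℤ.+ p) / 1
reflexive⇒supportValue-ℕ V (_ , r , W , polar) y V·y≤1 M a a∈MP@(μ , μ≥0 , Σμ≡M , _) a·y≡M =
  case dot-attainsBound-atVertex (λ q → ι (W q)) (ι a) y M y∈conv[W] a·W≤M a·y≡M of λ
  { (q , a·w≡M) → integral-nonNeg⇒ℕ (subst Integral a·w≡M (dot-integral a (W q))) M≥0 }
  where
  y∈conv[W] : LInConv W y
  y∈conv[W] = Equivalence.to (polar y) (λ x x∈P → InDilate-dot-≤ _ x y V·y≤1 x∈P)
  a·W≤M : ∀ q → dot (ι a) (ι (W q)) ≤ M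
  a·W≤M q = InDilate-dot-≤ _ (ι a) (ι (W q))
    (λ l → Equivalence.from (polar (ι (W q))) (vertex∈conv (λ q → ι (W q)) q)
             (ι (V l)) (vertex∈conv (λ l → ι (V l)) l))
    a∈MP
  M≥0 : 0ℚ ≤ M
  M≥0 = subst (0ℚ ≤_) Σμ≡M (Σℚ-nonNeg μ μ≥0)

reflexiveSimplex-facet-ℕ : ∀ {n} (V : Fin (suc n) → LPt n) → FullDimLatticeSimplex V → Reflexive V →
  (β : Fin (suc n) → ℚ) → Σℚ β ≡ 1ℚ → (∀ i → lincomb β (λ l → ι (V l)) i ≡ 0ℚ) →
  (j₀ : Fin (suc n)) → 0ℚ < β j₀ →
  (a : LPt n) (μ : Fin (suc n) → ℚ) → (∀ l → 0ℚ ≤ μ l) → μ j₀ ≡ 0ℚ →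
  (∀ i → ι a i ≡ lincomb μ (λ l → ι (V l)) i) → ∃[ p ] Σℚ μ ≡ (ℤ.+ p) / 1
reflexiveSimplex-facet-ℕ {n} V affInd reflexive β Σβ≡1 βV≡0 j₀ βj₀>0 a μ μ≥0 μj₀≡0 a≡μV =
  reflexive⇒supportValue-ℕ V reflexive y V·y≤1 (Σℚ μ) a (μ , μ≥0 , refl , a≡μV) a·y≡Σμ
  where
  P : Fin (suc n) → Pt n
  P l = ι (V l)
  open FacetNormal (facetNormal P affInd β Σβ≡1 βV≡0 j₀ βj₀>0)
  V·y≤1 : ∀ l → dot (P l) y ≤ 1ℚ
  V·y≤1 l = subst (_≤ 1ℚ) (sym (V·y≡ l)) (p-q≤p (0≤* (δ-nonNeg j₀ l) d≥0))
  a·y≡Σμ : dot (ι a) y ≡ Σℚ μ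
  a·y≡Σμ = begin
    dot (ι a) y                            ≡⟨ dot-lincomb μ P (ι a) y a≡μV ⟩
    Σℚ (λ l → μ l * dot (P l) y)           ≡⟨ Σℚ-cong (λ l → cong (μ l *_) (V·y≡ l)) ⟩
    Σℚ (λ l → μ l * (1ℚ - δ j₀ l * d))
      ≡⟨ Σℚ-cong (λ l → solve 3 (λ m e d → m :* (con 1ℚ :- e :* d) := m :- d :* (e :* m))
           refl (μ l) (δ j₀ l) d) ⟩
    Σℚ (λ l → μ l - d * (δ j₀ l * μ l))    ≡⟨ Σℚ-sub-* μ (λ l → δ j₀ l * μ l) d ⟩
    Σℚ μ - d * Σℚ (λ l → δ j₀ l * μ l)     ≡⟨ cong (λ z → Σℚ μ - d * z) (trans (Σℚ-δ-* j₀ μ) μj₀≡0) ⟩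
    Σℚ μ - d * 0ℚ                          ≡⟨ solve 2 (λ m d → m :- d :* con 0ℚ := m) refl (Σℚ μ) d ⟩
    Σℚ μ                                   ∎
    where open ≡-Reasoning

reflexiveSimplex-dilate-ℕ : ∀ {n} (V : Fin (suc n) → LPt n) →
  FullDimLatticeSimplex V → Reflexive V →
  (s : ℚ) (a : LPt n) → InDilate s (λ l → ι (V l)) (ι a) →
  ∃[ p ] Σ ℚ λ c → 0ℚ ≤ c × s ≡ (ℤ.+ p) / 1 + c × InDilate ((ℤ.+ p) / 1) (λ l → ι (V l)) (ι a)
reflexiveSimplex-dilate-ℕ {n} V affInd reflexive@((ε , ε>0 , ball) , _) s a (λs , λs≥0 , Σλs≡s , a≡λsV) =
  atLatticeDilate
    (reflexiveSimplex-facet-ℕ V affInd reflexive β Σβ≡1 βV≡0 j₀ β[j₀]>0 a μ λs-cβ≥0 λs-cβ[j₀]≡0 a≡μV)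
  where
  P : Fin (suc n) → Pt n
  P l = ι (V l)
  0∈P : LInConv V zeroPt
  0∈P = ball zeroPt (λ _ → ε>0)
  β : Fin (suc n) → ℚ
  β = proj₁ 0∈P
  β≥0 : ∀ j → 0ℚ ≤ β j
  β≥0 = proj₁ (proj₂ 0∈P)
  Σβ≡1 : Σℚ β ≡ 1ℚ
  Σβ≡1 = proj₁ (proj₂ (proj₂ 0∈P))
  βV≡0 : ∀ i → lincomb β P i ≡ 0ℚ
  βV≡0 i = sym (proj₂ (proj₂ (proj₂ 0∈P)) i)
  ∃β>0 : ∃[ j ] 0ℚ < β j
  ∃β>0 with Σℚ≢0⇒∃≢0 β (λ Σβ≡0 → 1≢0 (trans (sym Σβ≡1) Σβ≡0))
  ... | j , βj≢0 = j , 0≤p∧p≢0⇒0<p (β≥0 j) βj≢0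
  open MinRatio (minRatio β λs β≥0 λs≥0 ∃β>0)
  μ : Fin _ → ℚ
  μ l = λs l - c * β l
  a≡μV : ∀ i → ι a i ≡ lincomb μ P i
  a≡μV i = sym (begin
    lincomb μ P i                      ≡⟨ lincomb-sub-* λs β c P i ⟩
    lincomb λs P i - c * lincomb β P i  ≡⟨ cong₂ (λ x y → x - c * y) (sym (a≡λsV i)) (βV≡0 i) ⟩
    ι a i - c * 0ℚ                     ≡⟨ solve 2 (λ x c → x :- c :* con 0ℚ := x) refl (ι a i) c ⟩
    ι a i                              ∎)
    where open ≡-Reasoning
  -- Binding p by a pattern keeps Agda from unfolding the proof that computes it.
  atLatticeDilate : ∃[ p ] Σℚ μ ≡ (ℤ.+ p) / 1 →
    ∃[ p ] Σ ℚ λ c → 0ℚ ≤ c × s ≡ (ℤ.+ p) / 1 + c × InDilate ((ℤ.+ p) / 1) P (ι a)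
  atLatticeDilate (p , Σμ≡p) = p , c , c≥0 , s≡p+c , μ , λs-cβ≥0 , Σμ≡p , a≡μV
    where
    s≡p+c : s ≡ (ℤ.+ p) / 1 + c
    s≡p+c = begin
      s                  ≡⟨ solve 2 (λ s c → s := s :- c :* con 1ℚ :+ c) refl s c ⟩
      s - c * 1ℚ + c
        ≡⟨ cong (_+ c) (trans (Σℚ-sub-* λs β c) (cong₂ (λ x y → x - c * y) Σλs≡s Σβ≡1)) ⟨
      Σℚ μ + c           ≡⟨ cong (_+ c) Σμ≡p ⟩
      (ℤ.+ p) / 1 + c    ∎
      where open ≡-Reasoning

-- Free sums as block-diagonal families

relativeTo : ∀ {k N} → (Fin k → LPt N) → LPt N → Fin k → LPt N
relativeTo V v j t = V j t ℤ.- v t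

lincomb-relativeTo : ∀ {k N} (γ : Fin k → ℚ) (V : Fin k → LPt N) (v : LPt N) (i : Fin N) →
  lincomb γ (λ j → ι (relativeTo V v j)) i ≡ lincomb γ (λ j → ι (V j)) i - (v i / 1) * Σℚ γ
lincomb-relativeTo γ V v i = trans
  (Σℚ-cong (λ j → trans (cong (γ j *_) (/1-homo-- (V j i) (v i)))
    (solve 3 (λ g x y → g :* (x :- y) := g :* x :- y :* g) refl (γ j) (V j i / 1) (v i / 1))))
  (Σℚ-sub-* (λ j → γ j * (V j i / 1)) γ (v i / 1))

LInConv-relativeTo : ∀ {k N} (V : Fin k → LPt N) (v z : LPt N) →
  LInConv V (ι z) → LInConv (relativeTo V v) (ι (λ t → z t ℤ.- v t))
LInConv-relativeTo V v z (γ , γ≥0 , Σγ≡1 , z≡γV) = γ , γ≥0 , Σγ≡1 , λ i → begin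
  (z i ℤ.- v i) / 1                                   ≡⟨ /1-homo-- (z i) (v i) ⟩
  z i / 1 - v i / 1                                   ≡⟨ cong₂ _-_ (z≡γV i) (sym (*-identityʳ (v i / 1))) ⟩
  lincomb γ (λ j → ι (V j)) i - (v i / 1) * 1ℚ
    ≡⟨ cong (λ y → lincomb γ (λ j → ι (V j)) i - (v i / 1) * y) Σγ≡1 ⟨
  lincomb γ (λ j → ι (V j)) i - (v i / 1) * Σℚ γ     ≡⟨ lincomb-relativeTo γ V v i ⟨
  lincomb γ (λ j → ι (relativeTo V v j)) i           ∎
  where open ≡-Reasoning

InDilate-relativeTo : ∀ {k N} {t : ℚ} (V : Fin k → LPt N) (v : LPt N) {z : Pt N} →
  InDilate t (λ j → ι (relativeTo V v j)) z → InDilate t (λ j → ι (V j)) (λ i → z i + t * (v i / 1))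
InDilate-relativeTo {t = t} V v {z} (γ , γ≥0 , Σγ≡t , z≡γV′) = γ , γ≥0 , Σγ≡t , λ i → begin
  z i + t * (v i / 1)
    ≡⟨ cong₂ (λ x y → x + y * (v i / 1)) (z≡γV′ i) (sym Σγ≡t) ⟩
  lincomb γ (λ j → ι (relativeTo V v j)) i + Σℚ γ * (v i / 1)
    ≡⟨ cong (_+ Σℚ γ * (v i / 1)) (lincomb-relativeTo γ V v i) ⟩
  lincomb γ (λ j → ι (V j)) i - v i / 1 * Σℚ γ + Σℚ γ * (v i / 1)
    ≡⟨ solve 3 (λ l v s → l :- v :* s :+ s :* v := l) refl (lincomb γ (λ j → ι (V j)) i) (v i / 1) (Σℚ γ) ⟩
  lincomb γ (λ j → ι (V j)) i                                  ∎
  where open ≡-Reasoning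

relativeDilate⇒dilate : ∀ {k N} {t : ℚ} (c : ℚ) (q : ℕ) (V : Fin k → LPt N) (j : Fin k) (z : LPt N) →
  0ℚ ≤ c → t + c ≡ (ℤ.+ q) / 1 → InDilate t (λ l → ι (relativeTo V (V j) l)) (ι z) →
  InDilate ((ℤ.+ q) / 1) (λ l → ι (V l)) (ι (λ i → z i ℤ.+ ℤ.+ q ℤ.* V j i))
relativeDilate⇒dilate {t = t} c q V j z c≥0 t+c≡q z∈tV′ =
  InDilate-cong t+c≡q z+tv+cv≡z+qv
    (InDilate-addVertex c (λ l → ι (V l)) j c≥0 (InDilate-relativeTo V (V j) z∈tV′))
  where
  z+tv+cv≡z+qv : ∀ i → z i / 1 + t * (V j i / 1) + c * (V j i / 1) ≡ (z i ℤ.+ ℤ.+ q ℤ.* V j i) / 1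
  z+tv+cv≡z+qv i = begin
    z i / 1 + t * (V j i / 1) + c * (V j i / 1)
      ≡⟨ solve 4 (λ z t c v → z :+ t :* v :+ c :* v := z :+ (t :+ c) :* v) refl (z i / 1) t c (V j i / 1) ⟩
    z i / 1 + (t + c) * (V j i / 1)                ≡⟨ cong (λ w → z i / 1 + w * (V j i / 1)) t+c≡q ⟩
    z i / 1 + (ℤ.+ q) / 1 * (V j i / 1)
      ≡⟨ trans (/1-homo-+ (z i) (ℤ.+ q ℤ.* V j i)) (cong (z i / 1 +_) (/1-homo-* (ℤ.+ q) (V j i))) ⟨
    (z i ℤ.+ ℤ.+ q ℤ.* V j i) / 1                  ∎
    where open ≡-Reasoning

Σℤᵛ-relativeTo : ∀ {q N} (zs : Fin q → LPt N) (v x : LPt N) →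
  (∀ i → x i ℤ.+ ℤ.+ q ℤ.* v i ≡ Σℤᵛ zs i) → ∀ i → x i ≡ Σℤᵛ (relativeTo zs v) i
Σℤᵛ-relativeTo {q} zs v x x+qv≡Σzs i = /1-injective (begin
  x i / 1
    ≡⟨ solve 2 (λ x y → x := x :+ y :- y) refl (x i / 1) (Q * (v i / 1)) ⟩
  x i / 1 + Q * (v i / 1) - Q * (v i / 1)
    ≡⟨ cong (_- Q * (v i / 1)) (trans (/1-homo-+ (x i) (ℤ.+ q ℤ.* v i)) (cong (x i / 1 +_) (/1-homo-* (ℤ.+ q) (v i)))) ⟨
  (x i ℤ.+ ℤ.+ q ℤ.* v i) / 1 - Q * (v i / 1)       ≡⟨ cong (λ z → z / 1 - Q * (v i / 1)) (x+qv≡Σzs i) ⟩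
  Σℤᵛ zs i / 1 - Q * (v i / 1)                      ≡⟨ cong (_- Q * (v i / 1)) (Σℤᵛ-/1 zs i) ⟩
  Σℚ (λ t → zs t i / 1) - Q * (v i / 1)
    ≡⟨ cong (λ z → Σℚ (λ t → zs t i / 1) - z)
         (trans (*-comm Q (v i / 1)) (cong (v i / 1 *_) (trans (sym (*-identityʳ Q)) (sym (Σℚ-const q 1ℚ))))) ⟩
  Σℚ (λ t → zs t i / 1) - v i / 1 * Σℚ {q} (λ _ → 1ℚ)  ≡⟨ Σℚ-sub-* (λ t → zs t i / 1) (λ _ → 1ℚ) (v i / 1) ⟨
  Σℚ (λ t → zs t i / 1 - v i / 1 * 1ℚ)
    ≡⟨ Σℚ-cong (λ t → trans (cong (_-_ (zs t i / 1)) (*-identityʳ (v i / 1)))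
                            (sym (/1-homo-- (zs t i) (v i)))) ⟩
  Σℚ (λ t → relativeTo zs v t i / 1)                ≡⟨ Σℤᵛ-/1 (relativeTo zs v) i ⟨
  Σℤᵛ (relativeTo zs v) i / 1                       ∎)
  where
  open ≡-Reasoning
  Q : ℚ
  Q = (ℤ.+ q) / 1

-- freeSumGens VP VQ i is, by definition, blockDiag VP (relativeTo VQ (VQ i)).
blockDiag : ∀ {p q n m} → (Fin p → LPt n) → (Fin q → LPt m) → Fin (p ℕ.+ q) → LPt (n ℕ.+ m)
blockDiag {n = n} {m} Y Z = (λ t → Y t ++ zeroL {m}) ++ (λ t → zeroL {n} ++ Z t)

module _ {p q n m} (Y : Fin p → LPt n) (Z : Fin q → LPt m) where

  private
    Ŷ : Fin p → LPt (n ℕ.+ m)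
    Ŷ t = Y t ++ zeroL {m}
    Ẑ : Fin q → LPt (n ℕ.+ m)
    Ẑ t = zeroL {n} ++ Z t

  blockDiag-↑ˡ-↑ˡ : ∀ t i → blockDiag Y Z (t ↑ˡ q) (i ↑ˡ m) ≡ Y t i
  blockDiag-↑ˡ-↑ˡ t i = trans (cong (λ w → w (i ↑ˡ m)) (lookup-++ˡ Ŷ Ẑ t)) (lookup-++ˡ (Y t) (zeroL {m}) i)

  blockDiag-↑ˡ-↑ʳ : ∀ t i → blockDiag Y Z (t ↑ˡ q) (n ↑ʳ i) ≡ ℤ.+ 0
  blockDiag-↑ˡ-↑ʳ t i = trans (cong (λ w → w (n ↑ʳ i)) (lookup-++ˡ Ŷ Ẑ t)) (lookup-++ʳ (Y t) (zeroL {m}) i)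

  blockDiag-↑ʳ-↑ˡ : ∀ t i → blockDiag Y Z (p ↑ʳ t) (i ↑ˡ m) ≡ ℤ.+ 0
  blockDiag-↑ʳ-↑ˡ t i = trans (cong (λ w → w (i ↑ˡ m)) (lookup-++ʳ Ŷ Ẑ t)) (lookup-++ˡ (zeroL {n}) (Z t) i)

  blockDiag-↑ʳ-↑ʳ : ∀ t i → blockDiag Y Z (p ↑ʳ t) (n ↑ʳ i) ≡ Z t i
  blockDiag-↑ʳ-↑ʳ t i = trans (cong (λ w → w (n ↑ʳ i)) (lookup-++ʳ Ŷ Ẑ t)) (lookup-++ʳ (zeroL {n}) (Z t) i)

  lincomb-blockDiag-↑ˡ : ∀ (γ : Fin (p ℕ.+ q) → ℚ) i →
    lincomb γ (λ t → ι (blockDiag Y Z t)) (i ↑ˡ m) ≡ lincomb (λ t → γ (t ↑ˡ q)) (λ t → ι (Y t)) i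
  lincomb-blockDiag-↑ˡ γ i = trans (Σℚ-↑-split {p} {q} (λ t → γ t * ι (blockDiag Y Z t) (i ↑ˡ m)))
    (trans (cong₂ _+_ (Σℚ-cong (λ t → cong (λ z → γ (t ↑ˡ q) * (z / 1)) (blockDiag-↑ˡ-↑ˡ t i)))
                      (Σℚ-zero _ (λ t → trans (cong (λ z → γ (p ↑ʳ t) * (z / 1)) (blockDiag-↑ʳ-↑ˡ t i))
                                              (*-zeroʳ (γ (p ↑ʳ t))))))
      (+-identityʳ _))

  lincomb-blockDiag-↑ʳ : ∀ (γ : Fin (p ℕ.+ q) → ℚ) i →
    lincomb γ (λ t → ι (blockDiag Y Z t)) (n ↑ʳ i) ≡ lincomb (λ t → γ (p ↑ʳ t)) (λ t → ι (Z t)) i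
  lincomb-blockDiag-↑ʳ γ i = trans (Σℚ-↑-split {p} {q} (λ t → γ t * ι (blockDiag Y Z t) (n ↑ʳ i)))
    (trans (cong₂ _+_ (Σℚ-zero _ (λ t → trans (cong (λ z → γ (t ↑ˡ q) * (z / 1)) (blockDiag-↑ˡ-↑ʳ t i))
                                              (*-zeroʳ (γ (t ↑ˡ q)))))
                      (Σℚ-cong (λ t → cong (λ z → γ (p ↑ʳ t) * (z / 1)) (blockDiag-↑ʳ-↑ʳ t i))))
      (+-identityˡ _))

  Σℤᵛ-blockDiag-↑ˡ : ∀ i → Σℤᵛ (blockDiag Y Z) (i ↑ˡ m) ≡ Σℤᵛ Y i
  Σℤᵛ-blockDiag-↑ˡ i = /1-injective (begin
    Σℤᵛ (blockDiag Y Z) (i ↑ˡ m) / 1                ≡⟨ Σℤᵛ-/1 (blockDiag Y Z) (i ↑ˡ m) ⟩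
    Σℚ (λ t → blockDiag Y Z t (i ↑ˡ m) / 1)         ≡⟨ Σℚ-↑-split {p} {q} _ ⟩
    Σℚ (λ t → blockDiag Y Z (t ↑ˡ q) (i ↑ˡ m) / 1) + Σℚ (λ t → blockDiag Y Z (p ↑ʳ t) (i ↑ˡ m) / 1)
      ≡⟨ cong₂ _+_ (Σℚ-cong (λ t → cong (_/ 1) (blockDiag-↑ˡ-↑ˡ t i)))
                   (Σℚ-zero _ (λ t → cong (_/ 1) (blockDiag-↑ʳ-↑ˡ t i))) ⟩
    Σℚ (λ t → Y t i / 1) + 0ℚ                        ≡⟨ +-identityʳ _ ⟩
    Σℚ (λ t → Y t i / 1)                             ≡⟨ Σℤᵛ-/1 Y i ⟨
    Σℤᵛ Y i / 1                                      ∎)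
    where open ≡-Reasoning

  Σℤᵛ-blockDiag-↑ʳ : ∀ i → Σℤᵛ (blockDiag Y Z) (n ↑ʳ i) ≡ Σℤᵛ Z i
  Σℤᵛ-blockDiag-↑ʳ i = /1-injective (begin
    Σℤᵛ (blockDiag Y Z) (n ↑ʳ i) / 1                ≡⟨ Σℤᵛ-/1 (blockDiag Y Z) (n ↑ʳ i) ⟩
    Σℚ (λ t → blockDiag Y Z t (n ↑ʳ i) / 1)         ≡⟨ Σℚ-↑-split {p} {q} _ ⟩
    Σℚ (λ t → blockDiag Y Z (t ↑ˡ q) (n ↑ʳ i) / 1) + Σℚ (λ t → blockDiag Y Z (p ↑ʳ t) (n ↑ʳ i) / 1)
      ≡⟨ cong₂ _+_ (Σℚ-zero _ (λ t → cong (_/ 1) (blockDiag-↑ˡ-↑ʳ t i)))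
                   (Σℚ-cong (λ t → cong (_/ 1) (blockDiag-↑ʳ-↑ʳ t i))) ⟩
    0ℚ + Σℚ (λ t → Z t i / 1)                        ≡⟨ +-identityˡ _ ⟩
    Σℚ (λ t → Z t i / 1)                             ≡⟨ Σℤᵛ-/1 Z i ⟨
    Σℤᵛ Z i / 1                                      ∎)
    where open ≡-Reasoning

  blockDiag-∋ˡ : (y : LPt n) → LInConv Y (ι y) → LInConv (blockDiag Y Z) (ι (y ++ zeroL {m}))
  blockDiag-∋ˡ y (γ , γ≥0 , Σγ≡1 , y≡γY) = γ′ , ++-nonNeg γ 0s γ≥0 (λ _ → ≤-refl) , Σγ′≡1 , y0≡γ′B
    where
    0s : Fin q → ℚ
    0s _ = 0ℚ
    γ′ : Fin (p ℕ.+ q) → ℚ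
    γ′ = γ ++ 0s
    Σγ′≡1 : Σℚ γ′ ≡ 1ℚ
    Σγ′≡1 = trans (Σℚ-++ γ 0s) (trans (cong₂ _+_ Σγ≡1 (Σℚ-zero 0s (λ _ → refl))) (+-identityʳ 1ℚ))
    y0≡γ′B : ∀ i → ι (y ++ zeroL {m}) i ≡ lincomb γ′ (λ t → ι (blockDiag Y Z t)) i
    y0≡γ′B = ↑-elim _
      (λ i → begin
        (y ++ zeroL) (i ↑ˡ m) / 1                        ≡⟨ cong (_/ 1) (lookup-++ˡ y (zeroL {m}) i) ⟩
        y i / 1                                          ≡⟨ y≡γY i ⟩
        lincomb γ (λ t → ι (Y t)) i
          ≡⟨ Σℚ-cong (λ t → cong (_* (Y t i / 1)) (lookup-++ˡ γ 0s t)) ⟨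
        lincomb (λ t → γ′ (t ↑ˡ q)) (λ t → ι (Y t)) i    ≡⟨ lincomb-blockDiag-↑ˡ γ′ i ⟨
        lincomb γ′ (λ t → ι (blockDiag Y Z t)) (i ↑ˡ m)  ∎)
      (λ i → trans (cong (_/ 1) (lookup-++ʳ y (zeroL {m}) i))
        (sym (trans (lincomb-blockDiag-↑ʳ γ′ i)
                    (lincomb-zeroˡ (λ t → γ′ (p ↑ʳ t)) (λ t → ι (Z t)) i (lookup-++ʳ γ 0s)))))
      where open ≡-Reasoning

  blockDiag-∋ʳ : (z : LPt m) → LInConv Z (ι z) → LInConv (blockDiag Y Z) (ι (zeroL {n} ++ z))
  blockDiag-∋ʳ z (γ , γ≥0 , Σγ≡1 , z≡γZ) = γ′ , ++-nonNeg 0s γ (λ _ → ≤-refl) γ≥0 , Σγ′≡1 , 0z≡γ′B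
    where
    0s : Fin p → ℚ
    0s _ = 0ℚ
    γ′ : Fin (p ℕ.+ q) → ℚ
    γ′ = 0s ++ γ
    Σγ′≡1 : Σℚ γ′ ≡ 1ℚ
    Σγ′≡1 = trans (Σℚ-++ 0s γ) (trans (cong₂ _+_ (Σℚ-zero 0s (λ _ → refl)) Σγ≡1) (+-identityˡ 1ℚ))
    0z≡γ′B : ∀ i → ι (zeroL {n} ++ z) i ≡ lincomb γ′ (λ t → ι (blockDiag Y Z t)) i
    0z≡γ′B = ↑-elim _
      (λ i → trans (cong (_/ 1) (lookup-++ˡ (zeroL {n}) z i))
        (sym (trans (lincomb-blockDiag-↑ˡ γ′ i)
                    (lincomb-zeroˡ (λ t → γ′ (t ↑ˡ q)) (λ t → ι (Y t)) i (lookup-++ˡ 0s γ)))))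
      (λ i → begin
        (zeroL ++ z) (n ↑ʳ i) / 1                        ≡⟨ cong (_/ 1) (lookup-++ʳ (zeroL {n}) z i) ⟩
        z i / 1                                          ≡⟨ z≡γZ i ⟩
        lincomb γ (λ t → ι (Z t)) i
          ≡⟨ Σℚ-cong (λ t → cong (_* (Z t i / 1)) (lookup-++ʳ 0s γ t)) ⟨
        lincomb (λ t → γ′ (p ↑ʳ t)) (λ t → ι (Z t)) i    ≡⟨ lincomb-blockDiag-↑ʳ γ′ i ⟨
        lincomb γ′ (λ t → ι (blockDiag Y Z t)) (n ↑ʳ i)  ∎)
      where open ≡-Reasoning

  blockDiag-dilate-split : ∀ {K} (x : LPt (n ℕ.+ m)) → InDilate K (λ t → ι (blockDiag Y Z t)) (ι x) →
    Σ ℚ λ s → Σ ℚ λ t → 0ℚ ≤ t × s + t ≡ K ×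
      InDilate s (λ j → ι (Y j)) (ι (λ i → x (i ↑ˡ m))) × InDilate t (λ j → ι (Z j)) (ι (λ i → x (n ↑ʳ i)))
  blockDiag-dilate-split x (γ , γ≥0 , Σγ≡K , x≡γB) =
    Σℚ γY , Σℚ γZ , Σℚ-nonNeg γZ (λ t → γ≥0 (p ↑ʳ t)) , trans (sym (Σℚ-↑-split {p} {q} γ)) Σγ≡K ,
    (γY , (λ t → γ≥0 (t ↑ˡ q)) , refl , λ i → trans (x≡γB (i ↑ˡ m)) (lincomb-blockDiag-↑ˡ γ i)) ,
    (γZ , (λ t → γ≥0 (p ↑ʳ t)) , refl , λ i → trans (x≡γB (n ↑ʳ i)) (lincomb-blockDiag-↑ʳ γ i))
    where
    γY : Fin p → ℚ
    γY t = γ (t ↑ˡ q)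
    γZ : Fin q → ℚ
    γZ t = γ (p ↑ʳ t)

  Σℤᵛ-blockDiag : (x : LPt (n ℕ.+ m)) →
    (∀ i → x (i ↑ˡ m) ≡ Σℤᵛ Y i) → (∀ i → x (n ↑ʳ i) ≡ Σℤᵛ Z i) →
    ∀ I → x I ≡ Σℤᵛ (blockDiag Y Z) I
  Σℤᵛ-blockDiag x xˡ≡ΣY xʳ≡ΣZ = ↑-elim _
    (λ i → trans (xˡ≡ΣY i) (sym (Σℤᵛ-blockDiag-↑ˡ i)))
    (λ i → trans (xʳ≡ΣZ i) (sym (Σℤᵛ-blockDiag-↑ʳ i)))

blockDiag-members : ∀ {p q n m} {Y : Fin p → LPt n} {Z : Fin q → LPt m}
  {p′ q′} (ys : Fin p′ → LPt n) (zs : Fin q′ → LPt m) →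
  (∀ t → LInConv Y (ι (ys t))) → (∀ t → LInConv Z (ι (zs t))) →
  ∀ t → LInConv (blockDiag Y Z) (ι (blockDiag ys zs t))
blockDiag-members {n = n} {m} {Y} {Z} {p′} {q′} ys zs ys∈Y zs∈Z = ↑-elim _
  (λ t → subst (λ w → LInConv (blockDiag Y Z) (ι w)) (sym (lookup-++ˡ ŷs ẑs t))
           (blockDiag-∋ˡ Y Z (ys t) (ys∈Y t)))
  (λ t → subst (λ w → LInConv (blockDiag Y Z) (ι w)) (sym (lookup-++ʳ ŷs ẑs t))
           (blockDiag-∋ʳ Y Z (zs t) (zs∈Z t)))
  where
  ŷs : Fin p′ → LPt (n ℕ.+ m)
  ŷs t = ys t ++ zeroL {m}
  ẑs : Fin q′ → LPt (n ℕ.+ m)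
  ẑs t = zeroL {n} ++ zs t

complementaryDilation : ∀ {s t c : ℚ} {k p : ℕ} → s + t ≡ (ℤ.+ k) / 1 → s ≡ (ℤ.+ p) / 1 + c →
  0ℚ ≤ c → 0ℚ ≤ t → ∃[ q ] p ℕ.+ q ≡ k × t + c ≡ (ℤ.+ q) / 1
complementaryDilation {s} {t} {c} {k} {p} s+t≡k s≡p+c c≥0 t≥0 = k ℕ.∸ p , p+q≡k , t+c≡q
  where
  p≤k : p ℕ.≤ k
  p≤k = /1-cancel-≤ (≤-trans (subst ((ℤ.+ p) / 1 ≤_) (sym s≡p+c) (p≤p+q c≥0))
                             (subst (s ≤_) s+t≡k (p≤p+q t≥0)))
  p+q≡k : p ℕ.+ (k ℕ.∸ p) ≡ k
  p+q≡k = ℕ.m+[n∸m]≡n p≤k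
  P Q : ℚ
  P = (ℤ.+ p) / 1
  Q = (ℤ.+ (k ℕ.∸ p)) / 1
  t+c≡q : t + c ≡ Q
  t+c≡q = begin
    t + c                            ≡⟨ solve 3 (λ s t c → t :+ c := (s :+ t) :- (s :- c)) refl s t c ⟩
    (s + t) - (s - c)
      ≡⟨ cong₂ _-_ s+t≡k (trans (cong (_- c) s≡p+c) (solve 2 (λ p c → p :+ c :- c := p) refl P c)) ⟩
    (ℤ.+ k) / 1 - P                  ≡⟨ cong (λ k → (ℤ.+ k) / 1 - P) p+q≡k ⟨
    (ℤ.+ (p ℕ.+ (k ℕ.∸ p))) / 1 - P  ≡⟨ cong (_- P) (/1-homo-+ (ℤ.+ p) (ℤ.+ (k ℕ.∸ p))) ⟩
    P + Q - P                        ≡⟨ solve 2 (λ p q → p :+ q :- p := q) refl P Q ⟩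
    Q                                ∎
    where open ≡-Reasoning

theorem2p6 : (n m : ℕ) (VP : Fin (suc n) → LPt n) (VQ : Fin (suc m) → LPt m) →
    FullDimLatticeSimplex VP → FullDimLatticeSimplex VQ →
    IntegrallyClosed VP → IntegrallyClosed VQ →
    InInterior VP zeroPt → Reflexive VP →
    (i : Fin (suc m)) → IntegrallyClosed (freeSumGens VP VQ i)
theorem2p6 n m VP VQ simplexP _ closedP closedQ _ reflexiveP i k x x∈kG =
  case blockDiag-dilate-split VP (relativeTo VQ (VQ i)) x x∈kG of λ
  { (s , t , t≥0 , s+t≡k , a∈sP , b∈tQ′) →
  case reflexiveSimplex-dilate-ℕ VP simplexP reflexiveP s (λ j → x (j ↑ˡ m)) a∈sP of λ
  { (p , c , c≥0 , s≡p+c , a∈pP) →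
  case complementaryDilation s+t≡k s≡p+c c≥0 t≥0 of λ
  { (q , p+q≡k , t+c≡q) →
  case IntegrallyClosed⇒sum VP closedP p _ a∈pP of λ
  { (ys , ys∈P , a≡Σys) →
  case IntegrallyClosed⇒sum VQ closedQ q _
         (relativeDilate⇒dilate c q VQ i (λ j → x (n ↑ʳ j)) c≥0 t+c≡q b∈tQ′) of λ
  { (zs , zs∈Q , b+qv≡Σzs) →
  subst (λ K → Σ (Fin K → LPt (n ℕ.+ m)) λ xs →
           (∀ t → LInConv (freeSumGens VP VQ i) (ι (xs t))) × (∀ I → x I ≡ Σℤᵛ xs I))
    p+q≡k
    ( blockDiag ys (relativeTo zs (VQ i))
    , blockDiag-members ys _ ys∈P (λ t → LInConv-relativeTo VQ (VQ i) (zs t) (zs∈Q t))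
    , Σℤᵛ-blockDiag ys _ x a≡Σys (Σℤᵛ-relativeTo zs (VQ i) (λ j → x (n ↑ʳ j)) b+qv≡Σzs)) } } } } }
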